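{- Let $k$ be a positive integer and let $u : \mathbb{Z}^k \to \mathbb{Z}$ be a function. Let $\mathcal{B}$ be a subset of $\mathbb{Z}^k$ admitting a minimal complement $M$ in $\mathbb{Z}^k$. Then $u$ admits a moderation, and for every moderation $v$ of $u$, the subset $$M_v := \{(x, v(x)) : x \in M\}$$ of $\mathbb{Z}^{k+1}$ is a minimal complement in $\mathbb{Z}^{k+1}$ of every subset $X \subseteq \mathbb{Z}^{k+1}$ satisfying $$\mathcal{B} \times \mathbb{Z} \subseteq X \subseteq (\mathcal{B} \times \mathbb{Z}) \cup \bigcup_{x \in \mathbb{Z}^k \setminus \mathcal{B}} \big(\{x\} \times \{n \in \mathbb{Z} : n < u(x)\}\big).$$
   Context: For an abelian group $G$ and nonempty subsets $W, W' \subseteq G$, $W'$ is a complement of $W$ in $G$ if $W + W' = G$; it is a minimal complement if moreover $W + (W' \setminus \{w'\}) \neq G$ for every $w' \in W'$. Given a function $u : \mathbb{Z}^k \to \mathbb{Z}$, a function $v : \mathbb{Z}^k \to \mathbb{Z}$ is called a moderation of $u$ if for each $x_0 \in \mathbb{Z}^k$ the function $x \mapsto u(x) + v(x_0 - x)$ on $\mathbb{Z}^k$ is bounded above. -}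

module Defs where

open import Data.Nat using (ℕ)
open import Data.Integer using (ℤ; _+_; _-_; _≤_; _<_)
open import Data.Vec using (Vec; zipWith; _∷ʳ_)
open import Data.Product using (Σ; ∃; ∃-syntax; _×_)
open import Data.Sum using (_⊎_)
open import Relation.Nullary using (¬_)
open import Relation.Binary.PropositionalEquality using (_≡_; _≢_)

ℤ^ : ℕ → Set
ℤ^ k = Vec ℤ k

_⊕_ : {k : ℕ} → ℤ^ k → ℤ^ k → ℤ^ k
_⊕_ = zipWith _+_

_⊖_ : {k : ℕ} → ℤ^ k → ℤ^ k → ℤ^ k
_⊖_ = zipWith _-_

Subset : ℕ → Set₁
Subset k = ℤ^ k → Set

Nonempty : {k : ℕ} → Subset k → Set
Nonempty W = ∃[ w ] W w

SumsetCovers : {k : ℕ} → Subset k → Subset k → Set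
SumsetCovers {k} W W' = (g : ℤ^ k) → ∃[ w ] ∃[ w' ] (W w × W' w' × w ⊕ w' ≡ g)

IsComplement : {k : ℕ} → Subset k → Subset k → Set
IsComplement W W' = Nonempty W × Nonempty W' × SumsetCovers W W'

Remove : {k : ℕ} → Subset k → ℤ^ k → Subset k
Remove W' w' y = W' y × y ≢ w'

IsMinimalComplement : {k : ℕ} → Subset k → Subset k → Set
IsMinimalComplement W W' =
  IsComplement W W' × (∀ w' → W' w' → ¬ SumsetCovers W (Remove W' w'))

IsModeration : {k : ℕ} → (ℤ^ k → ℤ) → (ℤ^ k → ℤ) → Set
IsModeration {k} u v = (x₀ : ℤ^ k) → ∃[ C ] ((x : ℤ^ k) → u x + v (x₀ ⊖ x) ≤ C)

-- ℤ^{k+1} is Vec ℤ (suc k); the point (x , n) is x ∷ʳ n (last coordinate n).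

Graph : {k : ℕ} → Subset k → (ℤ^ k → ℤ) → Subset (ℕ.suc k)
Graph M v y = ∃[ x ] (M x × y ≡ x ∷ʳ v x)

LowerCond : {k : ℕ} → Subset k → Subset (ℕ.suc k) → Set
LowerCond B X = ∀ x n → B x → X (x ∷ʳ n)

UpperCond : {k : ℕ} → Subset k → (ℤ^ k → ℤ) → Subset (ℕ.suc k) → Set
UpperCond B u X =
  ∀ y → X y → ∃[ x ] ∃[ n ] (y ≡ x ∷ʳ n × (B x ⊎ (¬ B x × n < u x)))

module Submission where

-- Let R(y) be the maximum of ∣u∣
--     over the cube of sup-norm radius 2‖y‖ and put v(y) = -R(y).  By the
--     triangle inequality ‖x‖ ≤ ‖x₀‖ + ‖x₀ - x‖, the point x lies in the cube
--     attached to x₀ or to x₀ - x, so u(x) ≤ R(x₀) ⊔ R(x₀ - x), whence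
--     u(x) + v(x₀ - x) ≤ R(x₀).
--
-- Covering: (g , m) = (b , m - v(x)) + (x , v(x)) with
--     b + x = g.  Minimality: given (g , ·), choose the level C bounding
--     u(y) + v(g - y) over all y.  Any decomposition (g , C) = (y , t) + (x', v(x'))
--     with (y , t) ∈ X must have y ∈ B, since otherwise t < u(y) would give
--     C < u(y) + v(g - y) ≤ C.  Hence a cover of ℤ^{k+1} by X and M_v minus
--     one point projects to a cover of ℤ^k by B and M minus one point.

open import Defs
open import Data.Nat using (ℕ; suc)
open import Data.Integer using (ℤ)
open import Data.Product using (∃-syntax; _×_)

import Data.Nat as ℕ
import Data.Nat.Properties as ℕP
open import Data.Integer as ℤ using (+_; -[1+_]; ∣_∣; -_; +≤+; -≤+)
import Data.Integer.Properties as ℤP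
open import Data.Integer.Tactic.RingSolver using (solve-∀)
open import Data.Vec using ([]; _∷_; _∷ʳ_; initLast)
open import Data.Vec.Properties using (∷ʳ-injective)
open import Data.Product using (_,_)
open import Data.Sum using (inj₁; inj₂)
open import Relation.Binary.PropositionalEquality
open import Relation.Nullary using (¬_; contradiction)

a-[a-c]≡c : ∀ a c → a ℤ.- (a ℤ.- c) ≡ c
a-[a-c]≡c = solve-∀

[a+b]-b≡a : ∀ a b → (a ℤ.+ b) ℤ.- b ≡ a
[a+b]-b≡a = solve-∀

[a-b]+b≡a : ∀ a b → (a ℤ.- b) ℤ.+ b ≡ a
[a-b]+b≡a = solve-∀

‖_‖ : ∀ {k} → ℤ^ k → ℕ
‖ [] ‖    = 0
‖ c ∷ z ‖ = ∣ c ∣ ℕ.⊔ ‖ z ‖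

maxOnInterval : (ℤ → ℕ) → ℕ → ℕ
maxOnInterval h ℕ.zero    = h (+ 0)
maxOnInterval h (suc n) = (maxOnInterval h n ℕ.⊔ h (+ suc n)) ℕ.⊔ h -[1+ n ]

maxOnInterval-bound : ∀ h n c → ∣ c ∣ ℕ.≤ n → h c ℕ.≤ maxOnInterval h n
maxOnInterval-bound h ℕ.zero (+ .0) ℕ.z≤n = ℕP.≤-refl
maxOnInterval-bound h (suc n) c ∣c∣≤1+n with ℕP.m≤n⇒m<n∨m≡n ∣c∣≤1+n
... | inj₁ (ℕ.s≤s ∣c∣≤n) =
  ℕP.≤-trans (maxOnInterval-bound h n c ∣c∣≤n)
             (ℕP.≤-trans (ℕP.m≤m⊔n _ _) (ℕP.m≤m⊔n _ _))
maxOnInterval-bound h (suc n) (+ .(suc n)) _ | inj₂ refl =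
  ℕP.≤-trans (ℕP.m≤n⊔m (maxOnInterval h n) _) (ℕP.m≤m⊔n _ _)
maxOnInterval-bound h (suc n) -[1+ .n ] _ | inj₂ refl = ℕP.m≤n⊔m _ _

maxOnCube : ∀ {k} → (ℤ^ k → ℕ) → ℕ → ℕ
maxOnCube {ℕ.zero} f n = f []
maxOnCube {suc k}  f n = maxOnInterval (λ c → maxOnCube (λ z → f (c ∷ z)) n) n

maxOnCube-bound : ∀ {k} (f : ℤ^ k → ℕ) n z → ‖ z ‖ ℕ.≤ n → f z ℕ.≤ maxOnCube f n
maxOnCube-bound f n []      _ = ℕP.≤-refl
maxOnCube-bound f n (c ∷ z) ‖c∷z‖≤n =
  ℕP.≤-trans (maxOnCube-bound (λ z → f (c ∷ z)) n z (ℕP.m⊔n≤o⇒n≤o _ _ ‖c∷z‖≤n))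
             (maxOnInterval-bound _ n c (ℕP.m⊔n≤o⇒m≤o _ _ ‖c∷z‖≤n))

-- Triangle inequality in the form used: x = x₀ - (x₀ - x).
norm-triangle : ∀ {k} (x₀ x : ℤ^ k) → ‖ x ‖ ℕ.≤ ‖ x₀ ‖ ℕ.+ ‖ x₀ ⊖ x ‖
norm-triangle []       []      = ℕ.z≤n
norm-triangle (a ∷ x₀) (c ∷ x) = ℕP.⊔-lub ∣c∣≤ ‖x‖≤
  where
  open ℕP.≤-Reasoning
  ∣c∣≤ : ∣ c ∣ ℕ.≤ (∣ a ∣ ℕ.⊔ ‖ x₀ ‖) ℕ.+ (∣ a ℤ.- c ∣ ℕ.⊔ ‖ x₀ ⊖ x ‖)
  ∣c∣≤ = begin
    ∣ c ∣                                          ≡⟨ cong ∣_∣ (a-[a-c]≡c a c) ⟨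
    ∣ a ℤ.- (a ℤ.- c) ∣                            ≤⟨ ℤP.∣i-j∣≤∣i∣+∣j∣ a (a ℤ.- c) ⟩
    ∣ a ∣ ℕ.+ ∣ a ℤ.- c ∣                          ≤⟨ ℕP.+-mono-≤ (ℕP.m≤m⊔n ∣ a ∣ ‖ x₀ ‖) (ℕP.m≤m⊔n ∣ a ℤ.- c ∣ ‖ x₀ ⊖ x ‖) ⟩
    (∣ a ∣ ℕ.⊔ ‖ x₀ ‖) ℕ.+ (∣ a ℤ.- c ∣ ℕ.⊔ ‖ x₀ ⊖ x ‖) ∎
  ‖x‖≤ : ‖ x ‖ ℕ.≤ (∣ a ∣ ℕ.⊔ ‖ x₀ ‖) ℕ.+ (∣ a ℤ.- c ∣ ℕ.⊔ ‖ x₀ ⊖ x ‖)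
  ‖x‖≤ = begin
    ‖ x ‖                                          ≤⟨ norm-triangle x₀ x ⟩
    ‖ x₀ ‖ ℕ.+ ‖ x₀ ⊖ x ‖                          ≤⟨ ℕP.+-mono-≤ (ℕP.m≤n⊔m ∣ a ∣ ‖ x₀ ‖) (ℕP.m≤n⊔m ∣ a ℤ.- c ∣ ‖ x₀ ⊖ x ‖) ⟩
    (∣ a ∣ ℕ.⊔ ‖ x₀ ‖) ℕ.+ (∣ a ℤ.- c ∣ ℕ.⊔ ‖ x₀ ⊖ x ‖) ∎

-- The radius-2‖y‖ bound R(y) for ∣u∣.  Every x is covered by the cube of
-- x₀ or of x₀ - x, since ‖x‖ ≤ ‖x₀‖ + ‖x₀ - x‖ ≤ 2 (‖x₀‖ ⊔ ‖x₀ - x‖).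
module CubeBound {k} (u : ℤ^ k → ℤ) where

  R : ℤ^ k → ℕ
  R y = maxOnCube (λ z → ∣ u z ∣) (‖ y ‖ ℕ.+ ‖ y ‖)

  R-covers : ∀ x₀ x → ∣ u x ∣ ℕ.≤ R x₀ ℕ.⊔ R (x₀ ⊖ x)
  R-covers x₀ x with ℕP.≤-total ‖ x₀ ‖ ‖ x₀ ⊖ x ‖
  ... | inj₁ ‖x₀‖≤‖x₀-x‖ =
    ℕP.≤-trans (maxOnCube-bound _ _ x
                 (ℕP.≤-trans (norm-triangle x₀ x) (ℕP.+-monoˡ-≤ _ ‖x₀‖≤‖x₀-x‖)))
               (ℕP.m≤n⊔m _ _)
  ... | inj₂ ‖x₀-x‖≤‖x₀‖ =
    ℕP.≤-trans (maxOnCube-bound _ _ x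
                 (ℕP.≤-trans (norm-triangle x₀ x) (ℕP.+-monoʳ-≤ _ ‖x₀-x‖≤‖x₀‖)))
               (ℕP.m≤m⊔n _ _)

i≤+∣i∣ : ∀ i → i ℤ.≤ + ∣ i ∣
i≤+∣i∣ (+ n)    = ℤP.≤-refl
i≤+∣i∣ -[1+ n ] = -≤+

minus-below-max : ∀ i m n → ∣ i ∣ ℕ.≤ m ℕ.⊔ n → i ℤ.- + n ℤ.≤ + m
minus-below-max i m n ∣i∣≤m⊔n = begin
  i ℤ.- + n                ≤⟨ ℤP.+-monoˡ-≤ (- + n) i≤m+n ⟩
  + (m ℕ.+ n) ℤ.- + n      ≡⟨ cong (ℤ._- + n) (ℤP.pos-+ m n) ⟩
  (+ m ℤ.+ + n) ℤ.- + n    ≡⟨ [a+b]-b≡a (+ m) (+ n) ⟩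
  + m                      ∎
  where
  open ℤP.≤-Reasoning
  i≤m+n : i ℤ.≤ + (m ℕ.+ n)
  i≤m+n = ℤP.≤-trans (i≤+∣i∣ i) (+≤+ (ℕP.≤-trans ∣i∣≤m⊔n (ℕP.m⊔n≤m+n m n)))

moderation-exists : ∀ {k} (u : ℤ^ k → ℤ) → ∃[ v ] IsModeration u v
moderation-exists u = (λ y → - + R y) , λ x₀ → + R x₀ , λ x →
  minus-below-max (u x) (R x₀) (R (x₀ ⊖ _)) (R-covers x₀ x)
  where open CubeBound u

⊕-∷ʳ : ∀ {k} (y x : ℤ^ k) t s → (y ∷ʳ t) ⊕ (x ∷ʳ s) ≡ (y ⊕ x) ∷ʳ (t ℤ.+ s)
⊕-∷ʳ []      []      t s = refl
⊕-∷ʳ (a ∷ y) (b ∷ x) t s = cong ((a ℤ.+ b) ∷_) (⊕-∷ʳ y x t s)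

⊕-solve : ∀ {k} (y x : ℤ^ k) → x ≡ (y ⊕ x) ⊖ y
⊕-solve []      []      = refl
⊕-solve (a ∷ y) (b ∷ x) = cong₂ _∷_ (sym b+a-a≡b) (⊕-solve y x)
  where
  b+a-a≡b : (a ℤ.+ b) ℤ.- a ≡ b
  b+a-a≡b = trans (cong (ℤ._- a) (ℤP.+-comm a b)) ([a+b]-b≡a b a)

graph-covers : ∀ {k} {B M : Subset k} {X : Subset (suc k)} (v : ℤ^ k → ℤ)
  → SumsetCovers B M → LowerCond B X → SumsetCovers X (Graph M v)
graph-covers v covers lower g′ with initLast g′
... | g , m , refl with covers g
... | b , x , b∈B , x∈M , b+x≡g =
  b ∷ʳ (m ℤ.- v x) , x ∷ʳ v x , lower b _ b∈B , (x , x∈M , refl) ,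
  trans (⊕-∷ʳ b x _ _) (cong₂ _∷ʳ_ b+x≡g ([a-b]+b≡a m (v x)))

-- If
-- (g , C) = w + (x' , v(x')) with w ∈ X, then w = (y , t) with y ∈ B and
-- y + x' = g: were y ∉ B we would have t < u(y) and so
-- C = t + v(x') < u(y) + v(g - y) ≤ C.
top-level-lies-over-B : ∀ {k} {B : Subset k} {X : Subset (suc k)} (u v : ℤ^ k → ℤ)
  → UpperCond B u X
  → ∀ g C → (∀ y → u y ℤ.+ v (g ⊖ y) ℤ.≤ C)
  → ∀ w x′ → X w → w ⊕ (x′ ∷ʳ v x′) ≡ g ∷ʳ C
  → ∃[ y ] (B y × y ⊕ x′ ≡ g)
top-level-lies-over-B u v upper g C bound w x′ w∈X sum with upper w w∈X
... | y , t , refl , cases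
  with ∷ʳ-injective (y ⊕ x′) g (trans (sym (⊕-∷ʳ y x′ t (v x′))) sum)
... | y+x′≡g , t+vx′≡C with cases
...   | inj₁ y∈B      = y , y∈B , y+x′≡g
...   | inj₂ (_ , t<uy) = contradiction C<C (ℤP.<-irrefl refl)
  where
  open ℤP.≤-Reasoning
  x′≡g-y : x′ ≡ g ⊖ y
  x′≡g-y = trans (⊕-solve y x′) (cong (_⊖ y) y+x′≡g)
  C<C : C ℤ.< C
  C<C = begin-strict
    C                 ≡⟨ t+vx′≡C ⟨
    t ℤ.+ v x′        <⟨ ℤP.+-monoˡ-< (v x′) t<uy ⟩
    u y ℤ.+ v x′      ≡⟨ cong (λ z → u y ℤ.+ v z) x′≡g-y ⟩
    u y ℤ.+ v (g ⊖ y) ≤⟨ bound y ⟩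
    C                 ∎

-- Removing (x , v(x)) from the graph leaves a set that does not complement X,
-- because any cover would project, at the levels C, to a cover of ℤ^k by B
-- and M ∖ {x}.
graph-minimal : ∀ {k} {B M : Subset k} {X : Subset (suc k)} (u v : ℤ^ k → ℤ)
  → IsModeration u v → UpperCond B u X
  → (∀ x → M x → ¬ SumsetCovers B (Remove M x))
  → ∀ w′ → Graph M v w′ → ¬ SumsetCovers X (Remove (Graph M v) w′)
graph-minimal {B = B} {M} u v moderation upper minimalM .(x ∷ʳ v x) (x , x∈M , refl) coversX =
  minimalM x x∈M coversB
  where
  coversB : SumsetCovers B (Remove M x)
  coversB g with moderation g
  ... | C , bound with coversX (g ∷ʳ C)
  ... | w , .(x′ ∷ʳ v x′) , w∈X , ((x′ , x′∈M , refl) , x′-not-removed) , sum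
    with top-level-lies-over-B u v upper g C bound w x′ w∈X sum
  ... | y , y∈B , y+x′≡g =
    y , x′ , y∈B , (x′∈M , λ x′≡x → x′-not-removed (cong (λ z → z ∷ʳ v z) x′≡x)) , y+x′≡g

theorem4p6 : (k : ℕ) → (u : ℤ^ (suc k) → ℤ) → (B M : Subset (suc k))
    → IsMinimalComplement B M
    → (∃[ v ] IsModeration u v)
      × ((v : ℤ^ (suc k) → ℤ) → IsModeration u v
         → (X : Subset (suc (suc k))) → LowerCond B X → UpperCond B u X
         → IsMinimalComplement X (Graph M v))
theorem4p6 k u B M ((B≠∅ , M≠∅ , covers) , minimalM) =
  moderation-exists u , λ v moderation X lower upper →
    ( (X≠∅ lower , Graph≠∅ v , graph-covers v covers lower)
    , graph-minimal u v moderation upper minimalM )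
  where
  X≠∅ : ∀ {X} → LowerCond B X → Nonempty X
  X≠∅ lower = let (b , b∈B) = B≠∅ in b ∷ʳ + 0 , lower b (+ 0) b∈B
  Graph≠∅ : ∀ v → Nonempty (Graph M v)
  Graph≠∅ v = let (x , x∈M) = M≠∅ in x ∷ʳ v x , x , x∈M , refl
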